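{- Let $\mathfrak C$ be a class of groups that satisfies one of the following two conditions: (1) it contains groups $G$ and $H$ (possibly equal) and a nontrivial homomorphism $f:G\to Z(H)$; (2) it contains a group that is decomposable as a direct product of nontrivial groups. Then $\mathfrak C$ does not recognize coordinates.
   Context: $Z(H)$ denotes the center of $H$. Reduced product: for an ideal $\mathcal I$ on $\mathbb I$ (closed under subsets and finite unions, $\mathbb I\notin\mathcal I$), $\prod_{\mathcal I}G_i$ is $\prod_iG_i$ modulo $(a_i)\simeq(b_i)\iff\{i\mid a_i\ne b_i\}\in\mathcal I$; for $S\in\mathcal P(\mathbb I)/\mathcal I$, $\mathcal M\restriction S$ is the quotient onto a representative of $S$ with quotient map $\pi_S$. An isomorphism $\Phi:\prod_{\mathcal I}G_i\to\prod_{\mathcal J}H_j$ is isomorphically coordinate respecting if there is an isomorphism $\alpha:\mathcal P(\mathbb I)/\mathcal I\to\mathcal P(\mathbb J)/\mathcal J$ such that for all $S$ the map $\pi_S(a)\mapsto\pi_{\alpha(S)}(\Phi(a))$ is well defined. A class recognizes coordinates if every isomorphism between reduced products (any index sets and ideals, including the trivial ideal $\{\emptyset\}$, repetitions allowed) of its members is isomorphically coordinate respecting. -}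

module Defs where

open import Level using (Level; _⊔_; 0ℓ)
open import Data.Bool using (Bool; true; false; _∧_; _∨_; not)
open import Data.Bool.Properties using (∨-zeroʳ)
open import Data.Product using (Σ; ∃; ∃-syntax; _×_; _,_; proj₁; proj₂)
open import Relation.Binary.PropositionalEquality using (_≡_; refl)
open import Relation.Nullary using (¬_)
open import Algebra.Bundles using (Group; RawGroup)
open import Algebra.Structures using (IsGroup)
import Algebra.Construct.DirectProduct as DP
open import Algebra.Morphism.Structures using (module GroupMorphisms)

Subset : Set → Set
Subset I = I → Bool

_⊆ˢ_ : {I : Set} → Subset I → Subset I → Set
S ⊆ˢ T = ∀ i → S i ≡ true → T i ≡ true

∅ˢ : {I : Set} → Subset I
∅ˢ _ = false

fullˢ : {I : Set} → Subset I
fullˢ _ = true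

_∪ˢ_ : {I : Set} → Subset I → Subset I → Subset I
(S ∪ˢ T) i = S i ∨ T i

_∩ˢ_ : {I : Set} → Subset I → Subset I → Subset I
(S ∩ˢ T) i = S i ∧ T i

∁ˢ : {I : Set} → Subset I → Subset I
∁ˢ S i = not (S i)

xor : Bool → Bool → Bool
xor true b = not b
xor false b = b

_Δˢ_ : {I : Set} → Subset I → Subset I → Subset I
(S Δˢ T) i = xor (S i) (T i)

record Ideal (I : Set) : Set₁ where
  field
    _∈𝓘      : Subset I → Set
    ∅∈       : ∅ˢ ∈𝓘
    ⊆-closed : ∀ {S T} → S ⊆ˢ T → T ∈𝓘 → S ∈𝓘
    ∪-closed : ∀ {S T} → S ∈𝓘 → T ∈𝓘 → (S ∪ˢ T) ∈𝓘
    full∉    : ¬ (fullˢ ∈𝓘)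

-- Reduced product ∏_𝓘 G_i.
-- (a_i) ≃ (b_i) iff {i | a_i ≠ b_i} ∈ 𝓘; stated (classically
-- equivalently, constructively better behaved) as: there is X ∈ 𝓘
-- with a_i ≈ b_i for all i ∉ X.

module _ {c ℓ : Level} {I : Set} (𝓘 : Ideal I) (G : I → Group c ℓ) where
  open Ideal 𝓘

  private
    module G i = Group (G i)

  RPCarrier : Set c
  RPCarrier = (i : I) → G.Carrier i

  _≈[_]_ : RPCarrier → Subset I → RPCarrier → Set (ℓ ⊔ 0ℓ)
  a ≈[ S ] b = ∃[ X ] (X ∈𝓘 × (∀ i → S i ≡ true → X i ≡ false → G._≈_ i (a i) (b i)))

  _≃_ : RPCarrier → RPCarrier → Set ℓ
  a ≃ b = ∃[ X ] (X ∈𝓘 × (∀ i → X i ≡ false → G._≈_ i (a i) (b i)))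

  private
    ∨-false₁ : ∀ {x y : Bool} → (x ∨ y) ≡ false → x ≡ false
    ∨-false₁ {false} p = refl
    ∨-false₁ {true} ()
    ∨-false₂ : ∀ {x y : Bool} → (x ∨ y) ≡ false → y ≡ false
    ∨-false₂ {false} p = p
    ∨-false₂ {true} ()

    pw : ∀ {a b} → (∀ i → G._≈_ i (a i) (b i)) → a ≃ b
    pw f = ∅ˢ , ∅∈ , λ i _ → f i

  reducedProduct : Group c ℓ
  reducedProduct = record
    { Carrier = RPCarrier
    ; _≈_ = _≃_
    ; _∙_ = λ a b i → G._∙_ i (a i) (b i)
    ; ε = λ i → G.ε i
    ; _⁻¹ = λ a i → G._⁻¹ i (a i)
    ; isGroup = record
      { isMonoid = record
        { isSemigroup = record
          { isMagma = record
            { isEquivalence = record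
              { refl = pw (λ i → G.refl i)
              ; sym = λ { (X , X∈ , f) → X , X∈ , λ i p → G.sym i (f i p) }
              ; trans = λ { (X , X∈ , f) (Y , Y∈ , g) →
                  (X ∪ˢ Y) , ∪-closed X∈ Y∈ ,
                  λ i p → G.trans i (f i (∨-false₁ p)) (g i (∨-false₂ {X i} p)) }
              }
            ; ∙-cong = λ { (X , X∈ , f) (Y , Y∈ , g) →
                  (X ∪ˢ Y) , ∪-closed X∈ Y∈ ,
                  λ i p → G.∙-cong i (f i (∨-false₁ p)) (g i (∨-false₂ {X i} p)) }
            }
          ; assoc = λ x y z → pw (λ i → G.assoc i (x i) (y i) (z i))
          }
        ; identity = (λ x → pw (λ i → G.identityˡ i (x i)))
                   , (λ x → pw (λ i → G.identityʳ i (x i)))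
        }
      ; inverse = (λ x → pw (λ i → G.inverseˡ i (x i)))
                , (λ x → pw (λ i → G.inverseʳ i (x i)))
      ; ⁻¹-cong = λ { (X , X∈ , f) → X , X∈ , λ i p → G.⁻¹-cong i (f i p) }
      }
    }

IsGroupIso : {a b ℓ₁ ℓ₂ : Level} (G : Group a ℓ₁) (H : Group b ℓ₂) →
             (Group.Carrier G → Group.Carrier H) → Set (a ⊔ b ⊔ ℓ₁ ⊔ ℓ₂)
IsGroupIso G H f = GroupMorphisms.IsGroupIsomorphism (Group.rawGroup G) (Group.rawGroup H) f

IsGroupHom : {a b ℓ₁ ℓ₂ : Level} (G : Group a ℓ₁) (H : Group b ℓ₂) →
             (Group.Carrier G → Group.Carrier H) → Set (a ⊔ ℓ₁ ⊔ ℓ₂)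
IsGroupHom G H f = GroupMorphisms.IsGroupHomomorphism (Group.rawGroup G) (Group.rawGroup H) f

-- Isomorphisms of the quotient Boolean algebras P(I)/𝓘 → P(J)/𝒥,
-- presented by a map on representatives.

module _ {I J : Set} (𝓘 : Ideal I) (𝒥 : Ideal J) where
  private
    module 𝓘 = Ideal 𝓘
    module 𝒥 = Ideal 𝒥

  -- equality in P(I)/𝓘 : S ~ T iff S Δ T ∈ 𝓘
  record IsBoolAlgIso (α : Subset I → Subset J) : Set where
    field
      cong      : ∀ S T → (S Δˢ T) 𝓘.∈𝓘 → (α S Δˢ α T) 𝒥.∈𝓘
      ∪-homo    : ∀ S T → (α (S ∪ˢ T) Δˢ (α S ∪ˢ α T)) 𝒥.∈𝓘
      ∩-homo    : ∀ S T → (α (S ∩ˢ T) Δˢ (α S ∩ˢ α T)) 𝒥.∈𝓘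
      ∁-homo    : ∀ S → (α (∁ˢ S) Δˢ ∁ˢ (α S)) 𝒥.∈𝓘
      ∅-homo    : (α ∅ˢ Δˢ ∅ˢ) 𝒥.∈𝓘
      full-homo : (α fullˢ Δˢ fullˢ) 𝒥.∈𝓘
      injective : ∀ S T → (α S Δˢ α T) 𝒥.∈𝓘 → (S Δˢ T) 𝓘.∈𝓘
      surjective : ∀ T → ∃[ S ] ((α S Δˢ T) 𝒥.∈𝓘)

module _ {c ℓ : Level} {I J : Set} (𝓘 : Ideal I) (𝒥 : Ideal J)
         (G : I → Group c ℓ) (H : J → Group c ℓ) where

  IsoCoordRespecting : (Group.Carrier (reducedProduct 𝓘 G) →
                        Group.Carrier (reducedProduct 𝒥 H)) → Set (c ⊔ ℓ)
  IsoCoordRespecting Φ =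
    ∃[ α ] (IsBoolAlgIso 𝓘 𝒥 α ×
      -- π_S(a) ↦ π_{α(S)}(Φ a) is well defined
      (∀ (S : Subset I) a b → _≈[_]_ 𝓘 G a S b →
         _≈[_]_ 𝒥 H (Φ a) (α S) (Φ b)))

GroupClass : (c ℓ p : Level) → Set (Level.suc (c ⊔ ℓ) ⊔ Level.suc p)
GroupClass c ℓ p = Group c ℓ → Set p

RecognizesCoordinates : {c ℓ p : Level} → GroupClass c ℓ p → Set (Level.suc (c ⊔ ℓ) ⊔ p)
RecognizesCoordinates {c} {ℓ} 𝓒 =
  ∀ (I J : Set) (𝓘 : Ideal I) (𝒥 : Ideal J)
    (G : I → Group c ℓ) (H : J → Group c ℓ) →
    (∀ i → 𝓒 (G i)) → (∀ j → 𝓒 (H j)) →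
    (Φ : Group.Carrier (reducedProduct 𝓘 G) → Group.Carrier (reducedProduct 𝒥 H)) →
    IsGroupIso (reducedProduct 𝓘 G) (reducedProduct 𝒥 H) Φ →
    IsoCoordRespecting 𝓘 𝒥 G H Φ

NontrivialGroup : {c ℓ : Level} → Group c ℓ → Set (c ⊔ ℓ)
NontrivialGroup G = ∃[ x ] (¬ (Group._≈_ G x (Group.ε G)))

LandsInCenter : {c ℓ : Level} (G H : Group c ℓ) → (Group.Carrier G → Group.Carrier H) → Set (c ⊔ ℓ)
LandsInCenter G H f = ∀ x y → Group._≈_ H (Group._∙_ H (f x) y) (Group._∙_ H y (f x))

HasCentralHom : {c ℓ p : Level} → GroupClass c ℓ p → Set (Level.suc (c ⊔ ℓ) ⊔ p)
HasCentralHom {c} {ℓ} 𝓒 =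
  ∃[ G ] ∃[ H ] (𝓒 G × 𝓒 H ×
    ∃[ f ] (IsGroupHom G H f × LandsInCenter G H f ×
            ∃[ x ] (¬ (Group._≈_ H (f x) (Group.ε H)))))

HasDecomposable : {c ℓ p : Level} → GroupClass c ℓ p → Set (Level.suc (c ⊔ ℓ) ⊔ p)
HasDecomposable {c} {ℓ} 𝓒 =
  ∃[ G ] (𝓒 G × ∃[ A ] ∃[ B ] (NontrivialGroup {c} {ℓ} A × NontrivialGroup {c} {ℓ} B ×
    ∃[ φ ] IsGroupIso (DP.group A B) G φ))

{-# OPTIONS --safe #-}
-- Index by Bool with the trivial ideal, so that the reduced product is just a
-- product of two groups. A nontrivial central homomorphism f : G → Z(H) gives
-- the shear automorphism (g , h) ↦ (g , f g ∙ h) of G × H, and a decomposition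
-- G ≅ A × B gives the automorphism of G × G exchanging the B-components. In
-- both cases some a , b agreeing in coordinate true have images differing in
-- both coordinates, whereas a coordinate-respecting α sends the nonempty set
-- {true} to a nonempty set on which these images would have to agree.
module Submission where

open import Defs
open import Level using (Level; _⊔_)
open import Data.Bool using (Bool; true; false; _∨_)
open import Data.Empty using (⊥-elim)
open import Data.Product using (∃-syntax; _×_; _,_; proj₁; proj₂)
open import Data.Sum using (_⊎_; inj₁; inj₂)
open import Function.Base using (_∘_)
open import Function.Bundles using (Inverse)
open import Function.Definitions using (Congruent; Bijective; StrictlyInverseˡ; StrictlyInverseʳ)
open import Function.Properties.Bijection using (Bijection⇒Inverse)
open import Relation.Nullary using (¬_)
open import Relation.Binary.PropositionalEquality using (_≡_; refl; sym; trans; subst; cong₂)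
open import Algebra.Bundles using (Group)
open import Algebra.Morphism.Structures using (module GroupMorphisms)
open import Algebra.Morphism.Consequences using (homomorphic₂-inv)
import Algebra.Construct.DirectProduct as DP
import Algebra.Properties.Group as GroupProperties
import Function.Consequences.Setoid as FunctionConsequences
import Relation.Binary.Reasoning.Setoid as ≈-Reasoning

private
  variable
    c ℓ p : Level

xor-identityʳ : ∀ b → xor b false ≡ b
xor-identityʳ true  = refl
xor-identityʳ false = refl

xor≡true⇒∨≡true : ∀ a b → xor a b ≡ true → a ∨ b ≡ true
xor≡true⇒∨≡true true  _ _      = refl
xor≡true⇒∨≡true false _ b≡true = b≡true

true≢false : ¬ true ≡ false
true≢false ()

false-reflected : ∀ {a b} → (a ≡ true → b ≡ true) → b ≡ false → a ≡ false
false-reflected {false} _   _       = refl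
false-reflected {true}  a⇒b b≡false = ⊥-elim (true≢false (trans (sym (a⇒b refl)) b≡false))

module _ {I J : Set} {𝓘 : Ideal I} {𝒥 : Ideal J} {α : Subset I → Subset J}
         (α-iso : IsBoolAlgIso 𝓘 𝒥 α) where
  private
    module 𝓘 = Ideal 𝓘
    module 𝒥 = Ideal 𝒥
  open IsBoolAlgIso α-iso

  ∈-reflected : ∀ S → α S 𝒥.∈𝓘 → S 𝓘.∈𝓘
  ∈-reflected S αS∈𝒥 = 𝓘.⊆-closed S⊆SΔ∅ (injective S ∅ˢ αSΔα∅∈𝒥)
    where
    S⊆SΔ∅ : S ⊆ˢ (S Δˢ ∅ˢ)
    S⊆SΔ∅ i = trans (xor-identityʳ (S i))
    αSΔα∅⊆αS∪α∅Δ∅ : (α S Δˢ α ∅ˢ) ⊆ˢ (α S ∪ˢ (α ∅ˢ Δˢ ∅ˢ))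
    αSΔα∅⊆αS∪α∅Δ∅ i =
      subst (λ b → α S i ∨ b ≡ true) (sym (xor-identityʳ (α ∅ˢ i)))
      ∘ xor≡true⇒∨≡true (α S i) (α ∅ˢ i)
    αSΔα∅∈𝒥 : (α S Δˢ α ∅ˢ) 𝒥.∈𝓘
    αSΔα∅∈𝒥 = 𝒥.⊆-closed αSΔα∅⊆αS∪α∅Δ∅ (𝒥.∪-closed αS∈𝒥 ∅-homo)

trivialIdeal : {I : Set} → I → Ideal I
trivialIdeal i₀ = record
  { _∈𝓘      = λ S → ∀ i → S i ≡ false
  ; ∅∈       = λ _ → refl
  ; ⊆-closed = λ S⊆T T≡∅ i → false-reflected (S⊆T i) (T≡∅ i)
  ; ∪-closed = λ S≡∅ T≡∅ i → cong₂ _∨_ (S≡∅ i) (T≡∅ i)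
  ; full∉    = λ full≡∅ → true≢false (full≡∅ i₀)
  }

module _ {I : Set} (𝓘 : Ideal I) (K : I → Group c ℓ) where
  private
    module K i = Group (K i)
    open Ideal 𝓘

  pointwise⇒≃ : ∀ {a b} → (∀ i → K._≈_ i (a i) (b i)) → _≃_ 𝓘 K a b
  pointwise⇒≃ a≈b = ∅ˢ , ∅∈ , λ i _ → a≈b i

  pointwise⇒≈[] : ∀ {a b S} → (∀ i → S i ≡ true → K._≈_ i (a i) (b i)) → _≈[_]_ 𝓘 K a S b
  pointwise⇒≈[] a≈b = ∅ˢ , ∅∈ , λ i i∈S _ → a≈b i i∈S

module _ {I : Set} {i₀ : I} (K : I → Group c ℓ) where
  private
    module K i = Group (K i)
    𝓘₀ = trivialIdeal i₀

  ≃⇒pointwise : ∀ {a b} → _≃_ 𝓘₀ K a b → ∀ i → K._≈_ i (a i) (b i)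
  ≃⇒pointwise (X , X≡∅ , a≈b) i = a≈b i (X≡∅ i)

  ≈[]⇒pointwise : ∀ {a b S} → _≈[_]_ 𝓘₀ K a S b → ∀ i → S i ≡ true → K._≈_ i (a i) (b i)
  ≈[]⇒pointwise (X , X≡∅ , a≈b) i i∈S = a≈b i i∈S (X≡∅ i)

  -- α S is nonempty since α reflects the ideal, yet Φ a and Φ b would have to agree on it.
  ¬isoCoordRespecting : ∀ {Φ} (S : Subset I) {i} → S i ≡ true → ∀ a b →
    (∀ j → S j ≡ true → K._≈_ j (a j) (b j)) → (∀ j → ¬ K._≈_ j (Φ a j) (Φ b j)) →
    ¬ IsoCoordRespecting 𝓘₀ 𝓘₀ K K Φ
  ¬isoCoordRespecting S {i} i∈S a b a≈b Φa≉Φb (α , α-iso , α-respects) =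
    S∉𝓘₀ (∈-reflected α-iso S αS≡∅)
    where
    S∉𝓘₀ : ¬ (∀ j → S j ≡ false)
    S∉𝓘₀ S≡∅ = true≢false (trans (sym i∈S) (S≡∅ i))
    αS≡∅ : ∀ j → α S j ≡ false
    αS≡∅ j with α S j in j∈αS
    ... | false = refl
    ... | true  = ⊥-elim (Φa≉Φb j
                    (≈[]⇒pointwise (α-respects S a b (pointwise⇒≈[] 𝓘₀ K a≈b)) j j∈αS))

module _ {c₁ ℓ₁ c₂ ℓ₂} (P : Group c₁ ℓ₁) (Q : Group c₂ ℓ₂) where
  private
    module P = Group P
    module Q = Group Q

  isGroupIso-fromInverse : ∀ {Φ Ψ} → Congruent P._≈_ Q._≈_ Φ → Congruent Q._≈_ P._≈_ Ψ →
    (∀ x y → Φ (x P.∙ y) Q.≈ Φ x Q.∙ Φ y) →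
    StrictlyInverseˡ Q._≈_ Φ Ψ → StrictlyInverseʳ P._≈_ Φ Ψ →
    IsGroupIso P Q Φ
  isGroupIso-fromInverse {Φ} Φ-cong Ψ-cong Φ-homo Φ∘Ψ≈id Ψ∘Φ≈id = record
    { isGroupMonomorphism = record
      { isGroupHomomorphism = record
        { isMonoidHomomorphism = record
          { isMagmaHomomorphism = record
            { isRelHomomorphism = record { cong = Φ-cong }
            ; homo = Φ-homo
            }
          ; ε-homo = ε-homo
          }
        ; ⁻¹-homo = ⁻¹-homo
        }
      ; injective = proj₁ bijective
      }
    ; surjective = proj₂ bijective
    }
    where
    open FunctionConsequences P.setoid Q.setoid
    open GroupProperties Q using (identityˡ-unique; inverseˡ-unique)
    bijective : Bijective P._≈_ Q._≈_ Φ
    bijective = inverseᵇ⇒bijective (strictlyInverseˡ⇒inverseˡ Φ-cong Φ∘Ψ≈id ,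
                                    strictlyInverseʳ⇒inverseʳ Ψ-cong Ψ∘Φ≈id)
    ε-homo : Φ P.ε Q.≈ Q.ε
    ε-homo = identityˡ-unique (Φ P.ε) (Φ P.ε)
               (Q.trans (Q.sym (Φ-homo P.ε P.ε)) (Φ-cong (P.identityˡ P.ε)))
    ⁻¹-homo : ∀ x → Φ (x P.⁻¹) Q.≈ Φ x Q.⁻¹
    ⁻¹-homo x = inverseˡ-unique (Φ (x P.⁻¹)) (Φ x)
                  (Q.trans (Q.sym (Φ-homo (x P.⁻¹) x)) (Q.trans (Φ-cong (P.inverseˡ x)) ε-homo))

module TwoFactors (K : Bool → Group c ℓ) where
  private
    module K i = Group (K i)

  𝓘₀ : Ideal Bool
  𝓘₀ = trivialIdeal true

  RP : Group c ℓ
  RP = reducedProduct 𝓘₀ K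

  open Group RP public using (Carrier; _≈_; _∙_)

  componentwise : ∀ {a b} → K._≈_ false (a false) (b false) → K._≈_ true (a true) (b true) → a ≈ b
  componentwise a₀≈b₀ a₁≈b₁ = pointwise⇒≃ 𝓘₀ K λ { false → a₀≈b₀ ; true → a₁≈b₁ }

  components : ∀ {a b} → a ≈ b → ∀ i → K._≈_ i (a i) (b i)
  components = ≃⇒pointwise {i₀ = true} K

  Separating : (Carrier → Carrier) → Set (c ⊔ ℓ)
  Separating Φ = ∃[ a ] ∃[ b ] (K._≈_ true (a true) (b true) × (∀ i → ¬ K._≈_ i (Φ a i) (Φ b i)))

  separatingIso⇒¬RecognizesCoordinates : (𝓒 : GroupClass c ℓ p) → (∀ i → 𝓒 (K i)) →
    ∀ {Φ} → IsGroupIso RP RP Φ → Separating Φ → ¬ RecognizesCoordinates 𝓒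
  separatingIso⇒¬RecognizesCoordinates 𝓒 𝓒K {Φ} Φ-iso (a , b , a₁≈b₁ , Φa≉Φb) recognizes =
    ¬isoCoordRespecting {i₀ = true} K onlyTrue refl a b agree Φa≉Φb
      (recognizes Bool Bool 𝓘₀ 𝓘₀ K K 𝓒K 𝓒K Φ Φ-iso)
    where
    onlyTrue : Subset Bool
    onlyTrue i = i
    agree : ∀ i → onlyTrue i ≡ true → K._≈_ i (a i) (b i)
    agree true _ = a₁≈b₁

module Shear {G H : Group c ℓ} {f : Group.Carrier G → Group.Carrier H}
             (f-homo : IsGroupHom G H f) (f-central : LandsInCenter G H f) where
  private
    module G = Group G
    module H = Group H
  open GroupMorphisms.IsGroupHomomorphism f-homo using (⟦⟧-cong; homo; ε-homo)

  K : Bool → Group c ℓ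
  K false = G
  K true  = H

  open TwoFactors K

  shear unshear : Carrier → Carrier
  shear   a false = a false
  shear   a true  = f (a false) H.∙ a true
  unshear a false = a false
  unshear a true  = f (a false) H.⁻¹ H.∙ a true

  f-∙-interchange : ∀ g g′ h h′ → f (g G.∙ g′) H.∙ (h H.∙ h′) H.≈ (f g H.∙ h) H.∙ (f g′ H.∙ h′)
  f-∙-interchange g g′ h h′ = begin
    f (g G.∙ g′) H.∙ (h H.∙ h′)    ≈⟨ H.∙-congʳ (homo g g′) ⟩
    (f g H.∙ f g′) H.∙ (h H.∙ h′)  ≈⟨ H.assoc _ _ _ ⟩
    f g H.∙ (f g′ H.∙ (h H.∙ h′))  ≈⟨ H.∙-congˡ (H.assoc _ _ _) ⟨
    f g H.∙ ((f g′ H.∙ h) H.∙ h′)  ≈⟨ H.∙-congˡ (H.∙-congʳ (f-central g′ h)) ⟩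
    f g H.∙ ((h H.∙ f g′) H.∙ h′)  ≈⟨ H.∙-congˡ (H.assoc _ _ _) ⟩
    f g H.∙ (h H.∙ (f g′ H.∙ h′))  ≈⟨ H.assoc _ _ _ ⟨
    (f g H.∙ h) H.∙ (f g′ H.∙ h′)  ∎
    where open ≈-Reasoning H.setoid

  shear-cong : Congruent _≈_ _≈_ shear
  shear-cong a≈b = componentwise (components a≈b false)
    (H.∙-cong (⟦⟧-cong (components a≈b false)) (components a≈b true))

  unshear-cong : Congruent _≈_ _≈_ unshear
  unshear-cong a≈b = componentwise (components a≈b false)
    (H.∙-cong (H.⁻¹-cong (⟦⟧-cong (components a≈b false))) (components a≈b true))

  shear-homo : ∀ a b → shear (a ∙ b) ≈ shear a ∙ shear b
  shear-homo a b = componentwise G.refl (f-∙-interchange (a false) (b false) (a true) (b true))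

  shear-isGroupIso : IsGroupIso RP RP shear
  shear-isGroupIso = isGroupIso-fromInverse RP RP shear-cong unshear-cong shear-homo
    (λ a → componentwise G.refl (cancel (H.inverseʳ (f (a false))) (a true)))
    (λ a → componentwise G.refl (cancel (H.inverseˡ (f (a false))) (a true)))
    where
    cancel : ∀ {x y} → x H.∙ y H.≈ H.ε → ∀ z → x H.∙ (y H.∙ z) H.≈ z
    cancel xy≈ε z = H.trans (H.sym (H.assoc _ _ z)) (H.trans (H.∙-congʳ xy≈ε) (H.identityˡ z))

  shear-separating : ∀ {x} → ¬ f x H.≈ H.ε → Separating shear
  shear-separating {x} fx≉ε = a , b , H.refl , images-differ
    where
    a b : Carrier
    a false = G.ε
    a true  = H.ε
    b false = x
    b true  = H.ε
    fε≉fx : ¬ f G.ε H.≈ f x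
    fε≉fx fε≈fx = fx≉ε (H.trans (H.sym fε≈fx) ε-homo)
    images-differ : ∀ i → ¬ Group._≈_ (K i) (shear a i) (shear b i)
    images-differ false ε≈x    = fε≉fx (⟦⟧-cong ε≈x)
    images-differ true  fεε≈fxε = fε≉fx (∙-cancelʳ H.ε (f G.ε) (f x) fεε≈fxε)
      where open GroupProperties H using (∙-cancelʳ)

module Exchange {A B G : Group c ℓ} {φ : Group.Carrier (DP.group A B) → Group.Carrier G}
                (φ-iso : IsGroupIso (DP.group A B) G φ) where
  private
    module A = Group A
    module B = Group B
    module G = Group G
    P = DP.group A B
    module P = Group P
  open GroupMorphisms.IsGroupIsomorphism φ-iso using (⟦⟧-cong; ∙-homo; injective; surjective)

  φ-inverse : Inverse P.setoid G.setoid
  φ-inverse = Bijection⇒Inverse record { to = φ ; cong = ⟦⟧-cong ; bijective = injective , surjective }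

  open Inverse φ-inverse using (from-cong; inverse; strictlyInverseˡ; strictlyInverseʳ)
    renaming (from to ψ)

  ψ-homo : ∀ u v → ψ (u G.∙ v) P.≈ ψ u P.∙ ψ v
  ψ-homo = homomorphic₂-inv P.magma G.magma from-cong inverse ∙-homo

  π₁ : G.Carrier → A.Carrier
  π₁ = proj₁ ∘ ψ

  π₂ : G.Carrier → B.Carrier
  π₂ = proj₂ ∘ ψ

  mix : G.Carrier → G.Carrier → G.Carrier
  mix u v = φ (π₁ u , π₂ v)

  π₁-φ : ∀ p → π₁ (φ p) A.≈ proj₁ p
  π₁-φ p = proj₁ (strictlyInverseʳ p)

  π₂-φ : ∀ p → π₂ (φ p) B.≈ proj₂ p
  π₂-φ p = proj₂ (strictlyInverseʳ p)

  mix-cong : ∀ {u u′ v v′} → u G.≈ u′ → v G.≈ v′ → mix u v G.≈ mix u′ v′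
  mix-cong u≈u′ v≈v′ = ⟦⟧-cong (proj₁ (from-cong u≈u′) , proj₂ (from-cong v≈v′))

  mix-homo : ∀ u u′ v v′ → mix (u G.∙ u′) (v G.∙ v′) G.≈ mix u v G.∙ mix u′ v′
  mix-homo u u′ v v′ = G.trans (⟦⟧-cong (proj₁ (ψ-homo u u′) , proj₂ (ψ-homo v v′))) (∙-homo _ _)

  mix-involutive : ∀ u v → mix (mix u v) (mix v u) G.≈ u
  mix-involutive u v = G.trans (⟦⟧-cong (π₁-φ _ , π₂-φ _)) (strictlyInverseˡ u)

  open TwoFactors (λ _ → G)

  exchange : Carrier → Carrier
  exchange a false = mix (a false) (a true)
  exchange a true  = mix (a true) (a false)

  exchange-cong : Congruent _≈_ _≈_ exchange
  exchange-cong a≈b = componentwise (mix-cong (components a≈b false) (components a≈b true))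
                                    (mix-cong (components a≈b true) (components a≈b false))

  exchange-isGroupIso : IsGroupIso RP RP exchange
  exchange-isGroupIso = isGroupIso-fromInverse RP RP exchange-cong exchange-cong
    (λ a b → componentwise (mix-homo _ _ _ _) (mix-homo _ _ _ _))
    exchange-involutive exchange-involutive
    where
    exchange-involutive : ∀ a → exchange (exchange a) ≈ a
    exchange-involutive a = componentwise (mix-involutive _ _) (mix-involutive _ _)

  exchange-separating : NontrivialGroup A → NontrivialGroup B → Separating exchange
  exchange-separating (x , x≉ε) (y , y≉ε) = a , b , G.refl , images-differ
    where
    a b : Carrier
    a false = φ (A.ε , B.ε)
    a true  = G.ε
    b false = φ (x , y)
    b true  = G.ε
    images-differ : ∀ i → ¬ exchange a i G.≈ exchange b i
    images-differ false e = x≉ε (begin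
      x                      ≈⟨ π₁-φ (x , y) ⟨
      π₁ (b false)           ≈⟨ π₁-φ _ ⟨
      π₁ (exchange b false)  ≈⟨ proj₁ (from-cong e) ⟨
      π₁ (exchange a false)  ≈⟨ π₁-φ _ ⟩
      π₁ (a false)           ≈⟨ π₁-φ (A.ε , B.ε) ⟩
      A.ε                    ∎)
      where open ≈-Reasoning A.setoid
    images-differ true e = y≉ε (begin
      y                      ≈⟨ π₂-φ (x , y) ⟨
      π₂ (b false)           ≈⟨ π₂-φ _ ⟨
      π₂ (exchange b true)   ≈⟨ proj₂ (from-cong e) ⟨
      π₂ (exchange a true)   ≈⟨ π₂-φ _ ⟩
      π₂ (a false)           ≈⟨ π₂-φ (A.ε , B.ε) ⟩
      B.ε                    ∎)
      where open ≈-Reasoning B.setoid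

centralHom⇒¬RecognizesCoordinates : (𝓒 : GroupClass c ℓ p) → HasCentralHom 𝓒 → ¬ RecognizesCoordinates 𝓒
centralHom⇒¬RecognizesCoordinates 𝓒 (G , H , 𝓒G , 𝓒H , f , f-homo , f-central , x , fx≉ε) =
  separatingIso⇒¬RecognizesCoordinates 𝓒 𝓒K shear-isGroupIso (shear-separating fx≉ε)
  where
  open Shear f-homo f-central
  open TwoFactors K using (separatingIso⇒¬RecognizesCoordinates)
  𝓒K : ∀ i → 𝓒 (K i)
  𝓒K false = 𝓒G
  𝓒K true  = 𝓒H

decomposable⇒¬RecognizesCoordinates : (𝓒 : GroupClass c ℓ p) → HasDecomposable 𝓒 → ¬ RecognizesCoordinates 𝓒
decomposable⇒¬RecognizesCoordinates 𝓒 (G , 𝓒G , A , B , A-nontrivial , B-nontrivial , φ , φ-iso) =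
  separatingIso⇒¬RecognizesCoordinates 𝓒 (λ _ → 𝓒G) exchange-isGroupIso
    (exchange-separating A-nontrivial B-nontrivial)
  where
  open Exchange {A = A} {B = B} {G = G} φ-iso
  open TwoFactors (λ _ → G) using (separatingIso⇒¬RecognizesCoordinates)

theorem5p1 : {c ℓ p : Level} (𝓒 : GroupClass c ℓ p) →
    (HasCentralHom 𝓒 ⊎ HasDecomposable 𝓒) → ¬ RecognizesCoordinates 𝓒
theorem5p1 𝓒 (inj₁ central) = centralHom⇒¬RecognizesCoordinates 𝓒 central
theorem5p1 𝓒 (inj₂ decomposable) = decomposable⇒¬RecognizesCoordinates 𝓒 decomposable
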